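{- Let $s$ be a natural number and $r$ an even natural number with $r \leq s$. Then, as elements of $\mathbb{Q}(v,k)$, \[ \sum_{i=0}^{r} (-1)^i \binom{r}{i} h_{s, s-r+i}\, h_{s, s-i} = \frac{r!}{(r/2)!}\cdot \frac{(v-k-s)^{\overline{r/2}}\,(k-s)^{\overline{s-r/2+1}}\,(k-s)^{\overline{s-r+1}}}{(v-2s+1)^{\overline{s}}\,(v-2s+1)^{\overline{s-r/2}}}. \]
   Context: Notation: $x^{\overline{n}} = \prod_{j=0}^{n-1}(x+j)$, with $x^{\overline{0}} = 1$. For $i \in \{0,\dots,s\}$, $h_{s,i} := \frac{(k-s)^{\overline{i+1}}}{(v-2s+1)^{\overline{i}}} \in \mathbb{Q}(v,k)$. -}

module Defs where

open import Data.Nat as ℕ using (ℕ; zero; suc)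
open import Data.Nat.Combinatorics using (_C_)
open import Data.Integer using (+_)
open import Data.Rational using (ℚ; 0ℚ; 1ℚ; _+_; _-_; _*_; -_; _÷_; _/_; ≢-nonZero)
open import Data.Rational.Properties using (_≟_)
open import Relation.Nullary using (yes; no)

ι : ℕ → ℚ
ι n = + n / 1

rise : ℚ → ℕ → ℚ
rise x zero = 1ℚ
rise x (suc n) = rise x n * (x + ι n)

-- total division (value 0 when dividing by 0); only used where the
-- divisor is guaranteed nonzero by the hypotheses of the theorem
_⊘_ : ℚ → ℚ → ℚ
p ⊘ q with q ≟ 0ℚ
... | yes _ = 0ℚ
... | no q≢0 = _÷_ p q {{≢-nonZero q≢0}}

sgn : ℕ → ℚ
sgn zero = 1ℚ
sgn (suc i) = - sgn i

Σ≤ : ℕ → (ℕ → ℚ) → ℚ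
Σ≤ zero f = f 0
Σ≤ (suc n) f = Σ≤ n f + f (suc n)

h : ℕ → ℕ → ℚ → ℚ → ℚ
h s i v k = rise (k - ι s) (suc i) ⊘ rise (v - ι (s ℕ.+ s) + 1ℚ) i

fact : ℕ → ℚ
fact zero = 1ℚ
fact (suc n) = fact n * ι (suc n)

LHS : ℕ → ℕ → ℚ → ℚ → ℚ
LHS s r v k = Σ≤ r (λ i → sgn i * ι (r C i) * h s (s ℕ.∸ r ℕ.+ i) v k * h s (s ℕ.∸ i) v k)

-- right-hand side of Theorem 3.3, with m = r/2
RHS : ℕ → ℕ → ℕ → ℚ → ℚ → ℚ
RHS s r m v k =
  (fact r ⊘ fact m) *
  ((rise (v - k - ι s) m * rise (k - ι s) (s ℕ.∸ m ℕ.+ 1) * rise (k - ι s) (s ℕ.∸ r ℕ.+ 1))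
   ⊘ (rise (v - ι (s ℕ.+ s) + 1ℚ) s * rise (v - ι (s ℕ.+ s) + 1ℚ) (s ℕ.∸ m)))

-- the largest denominator factor (v-2s+1)^{rising s}; every other
-- denominator occurring in the theorem divides it
den : ℕ → ℚ → ℚ
den s v = rise (v - ι (s ℕ.+ s) + 1ℚ) s

-- Put n = s − r, a = k − s, b = v − 2s + 1, A = a + n + 1 and B = b + n. Then
-- h_{s,n+q} = H · t_q with H = (a)_{n+1} / (b)_n and t_q = (A)_q / (B)_q, so the
-- left-hand side is H² · S_r for Dixon's well-poised sum
-- S_r = Σ_i (−1)^i C(r,i) t_i t_{r−i}. Creative telescoping with an explicit
-- rational certificate gives the recurrence
-- (B+r)(B+r+1)(2B+r) S_{r+2} = (r+1)(2B−2A+r)(2A+r) S_r, and iterating it from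
-- S_0 = 1 yields S_{2m} = (2m)!/m! · (B−A)_m (A)_m / ((B)_{2m} (B)_m), which is
-- the right-hand side divided by H².
module Submission where

open import Defs
open import Data.Integer using (+_)
import Data.Integer.Base as ℤ
import Data.Integer.Properties as ℤₚ
open import Data.List using (_∷_; [])
open import Data.Nat as ℕ using (ℕ; zero; suc; _≤_; _<_; z≤n; s≤s; _!)
import Data.Nat.Properties as ℕₚ
open import Data.Nat.Combinatorics using (_C_; nCn≡1; nC1≡n; nCk≡nC[n∸k]; k![n∸k]!∣n!)
open import Data.Nat.Combinatorics.Specification using (nCk≡n!/k![n-k]!)
open import Data.Nat.DivMod using (m/n*n≡m)
import Data.Nat.Tactic.RingSolver as ℕ-Solver
open import Data.Rational using (ℚ; 0ℚ; 1ℚ; _+_; _*_; _-_; -_; 1/_; toℚᵘ; ≢-nonZero)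
import Data.Rational.Properties as ℚ
open import Data.Rational.Unnormalised using (mkℚᵘ; *≡*; _≃_) renaming (_+_ to _+ᵘ_; _*_ to _*ᵘ_)
import Data.Rational.Unnormalised.Properties as ℚᵘ
open import Data.Product using (_,_)
open import Level using (0ℓ)
open import Relation.Nullary using (yes; no; contradiction)
open import Relation.Nullary.Decidable using (dec⇒maybe)
open import Relation.Binary.PropositionalEquality
open import Tactic.RingSolver using (solve-∀; solve)
open import Tactic.RingSolver.Core.AlmostCommutativeRing using (AlmostCommutativeRing; fromCommutativeRing)
open import Algebra.Bundles using (CommutativeMonoid)
import Algebra.Properties.CommutativeSemigroup as CommutativeSemigroupProperties

open CommutativeSemigroupProperties (CommutativeMonoid.commutativeSemigroup ℚ.*-1-commutativeMonoid)
  using (interchange; x∙yz≈y∙xz; xy∙z≈x∙zy; xy∙z≈xz∙y)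

ℚ-ring : AlmostCommutativeRing 0ℓ 0ℓ
ℚ-ring = fromCommutativeRing ℚ.+-*-commutativeRing (λ x → dec⇒maybe (0ℚ ℚ.≟ x))

toℚᵘ-ι : ∀ n → toℚᵘ (ι n) ≃ mkℚᵘ (+ n) 0
toℚᵘ-ι n = ℚ.toℚᵘ-fromℚᵘ (mkℚᵘ (+ n) 0)

ι-+ : ∀ m n → ι (m ℕ.+ n) ≡ ι m + ι n
ι-+ m n = ℚ.toℚᵘ-injective (begin
    toℚᵘ (ι (m ℕ.+ n))              ≈⟨ toℚᵘ-ι (m ℕ.+ n) ⟩
    mkℚᵘ (+ (m ℕ.+ n)) 0            ≈⟨ *≡* (cong (ℤ._* (+ 1)) (trans (ℤₚ.pos-+ m n)
                                          (sym (cong₂ ℤ._+_ (ℤₚ.*-identityʳ (+ m)) (ℤₚ.*-identityʳ (+ n)))))) ⟩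
    mkℚᵘ (+ m) 0 +ᵘ mkℚᵘ (+ n) 0    ≈⟨ ℚᵘ.+-cong (toℚᵘ-ι m) (toℚᵘ-ι n) ⟨
    toℚᵘ (ι m) +ᵘ toℚᵘ (ι n)        ≈⟨ ℚ.toℚᵘ-homo-+ (ι m) (ι n) ⟨
    toℚᵘ (ι m + ι n)                 ∎)
  where open ℚᵘ.≃-Reasoning

ι-* : ∀ m n → ι (m ℕ.* n) ≡ ι m * ι n
ι-* m n = ℚ.toℚᵘ-injective (begin
    toℚᵘ (ι (m ℕ.* n))              ≈⟨ toℚᵘ-ι (m ℕ.* n) ⟩
    mkℚᵘ (+ (m ℕ.* n)) 0            ≈⟨ *≡* (cong (ℤ._* (+ 1)) (ℤₚ.pos-* m n)) ⟩
    mkℚᵘ (+ m) 0 *ᵘ mkℚᵘ (+ n) 0    ≈⟨ ℚᵘ.*-cong (toℚᵘ-ι m) (toℚᵘ-ι n) ⟨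
    toℚᵘ (ι m) *ᵘ toℚᵘ (ι n)        ≈⟨ ℚ.toℚᵘ-homo-* (ι m) (ι n) ⟨
    toℚᵘ (ι m * ι n)                 ∎)
  where open ℚᵘ.≃-Reasoning

ι-suc : ∀ n → ι (suc n) ≡ ι n + 1ℚ
ι-suc n = trans (ι-+ 1 n) (ℚ.+-comm 1ℚ (ι n))

ι-2+ : ∀ n → ι (2 ℕ.+ n) ≡ ι n + 1ℚ + 1ℚ
ι-2+ n = trans (ι-suc (suc n)) (cong (_+ 1ℚ) (ι-suc n))

ι-suc≢0 : ∀ n → ι (suc n) ≢ 0ℚ
ι-suc≢0 n eq = ℚ.<-irrefl (sym eq) (ℚ.positive⁻¹ (ι (suc n)) {{ℚ.normalize-pos (suc n) 1}})

open ≡-Reasoning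

*-cancelʳ : ∀ {p q} r → r ≢ 0ℚ → p * r ≡ q * r → p ≡ q
*-cancelʳ {p} {q} r r≢0 eq = begin
    p              ≡⟨ x*r*1/r≡x p ⟨
    p * r * 1/ r   ≡⟨ cong (_* 1/ r) eq ⟩
    q * r * 1/ r   ≡⟨ x*r*1/r≡x q ⟩
    q              ∎
  where
  instance _ = ≢-nonZero r≢0
  x*r*1/r≡x : ∀ x → x * r * 1/ r ≡ x
  x*r*1/r≡x x = trans (ℚ.*-assoc x r (1/ r)) (trans (cong (x *_) (ℚ.*-inverseʳ r)) (ℚ.*-identityʳ x))

*-≢0 : ∀ {p q} → p ≢ 0ℚ → q ≢ 0ℚ → p * q ≢ 0ℚ
*-≢0 {p} {q} p≢0 q≢0 pq≡0 = p≢0 (*-cancelʳ q q≢0 (trans pq≡0 (sym (ℚ.*-zeroˡ q))))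

*-≢0ˡ : ∀ {p} q → p * q ≢ 0ℚ → p ≢ 0ℚ
*-≢0ˡ q pq≢0 p≡0 = pq≢0 (trans (cong (_* q) p≡0) (ℚ.*-zeroˡ q))

*-≢0ʳ : ∀ p {q} → p * q ≢ 0ℚ → q ≢ 0ℚ
*-≢0ʳ p pq≢0 q≡0 = pq≢0 (trans (cong (p *_) q≡0) (ℚ.*-zeroʳ p))

p⊘q*q≡p : ∀ p {q} → q ≢ 0ℚ → (p ⊘ q) * q ≡ p
p⊘q*q≡p p {q} q≢0 with q ℚ.≟ 0ℚ
... | yes q≡0 = contradiction q≡0 q≢0
... | no q≢0′ = trans (ℚ.*-assoc p _ q)
                  (trans (cong (p *_) (ℚ.*-inverseˡ q {{≢-nonZero q≢0′}})) (ℚ.*-identityʳ p))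

*≡⇒≡⊘ : ∀ {p q r} → q ≢ 0ℚ → r * q ≡ p → r ≡ p ⊘ q
*≡⇒≡⊘ {p} q≢0 eq = *-cancelʳ _ q≢0 (trans eq (sym (p⊘q*q≡p p q≢0)))

⊘-*-⊘ : ∀ p {q} p′ {q′} → q ≢ 0ℚ → q′ ≢ 0ℚ → (p ⊘ q) * (p′ ⊘ q′) ≡ (p * p′) ⊘ (q * q′)
⊘-*-⊘ p {q} p′ {q′} q≢0 q′≢0 = *≡⇒≡⊘ (*-≢0 q≢0 q′≢0)
  (trans (interchange (p ⊘ q) (p′ ⊘ q′) q q′) (cong₂ _*_ (p⊘q*q≡p p q≢0) (p⊘q*q≡p p′ q′≢0)))

fact≢0 : ∀ n → fact n ≢ 0ℚ
fact≢0 zero    ()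
fact≢0 (suc n) = *-≢0 (fact≢0 n) (ι-suc≢0 n)

ι-*-cong : ∀ a b c d → a ℕ.* b ≡ c ℕ.* d → ι a * ι b ≡ ι c * ι d
ι-*-cong a b c d eq = trans (sym (ι-* a b)) (trans (cong ι eq) (ι-* c d))

C*!*!≡! : ∀ k d → ((k ℕ.+ d) C k) ℕ.* (k ! ℕ.* d !) ≡ (k ℕ.+ d) !
C*!*!≡! k d = begin
    ((k ℕ.+ d) C k) ℕ.* (k ! ℕ.* d !)
      ≡⟨ cong (λ e → ((k ℕ.+ d) C k) ℕ.* (k ! ℕ.* e !)) (ℕₚ.m+n∸m≡n k d) ⟨
    ((k ℕ.+ d) C k) ℕ.* (k ! ℕ.* (k ℕ.+ d ℕ.∸ k) !)
      ≡⟨ cong (ℕ._* (k ! ℕ.* (k ℕ.+ d ℕ.∸ k) !)) (nCk≡n!/k![n-k]! k≤k+d) ⟩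
    (k ℕ.+ d) ! ℕ./ (k ! ℕ.* (k ℕ.+ d ℕ.∸ k) !) ℕ.* (k ! ℕ.* (k ℕ.+ d ℕ.∸ k) !)
      ≡⟨ m/n*n≡m (k![n∸k]!∣n! k≤k+d) ⟩
    (k ℕ.+ d) ! ∎
  where
  k≤k+d = ℕₚ.m≤m+n k d
  instance _ = ℕₚ._!*_!≢0 k (k ℕ.+ d ℕ.∸ k)

suc-C*!*! : ∀ k d → suc (k ℕ.+ d) ! ≡ ((k ℕ.+ d) C k) ℕ.* suc (k ℕ.+ d) ℕ.* (k ! ℕ.* d !)
suc-C*!*! k d = begin
    suc (k ℕ.+ d) ℕ.* (k ℕ.+ d) !                          ≡⟨ cong (suc (k ℕ.+ d) ℕ.*_) (C*!*!≡! k d) ⟨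
    suc (k ℕ.+ d) ℕ.* (((k ℕ.+ d) C k) ℕ.* (k ! ℕ.* d !))  ≡⟨ swap (suc (k ℕ.+ d)) ((k ℕ.+ d) C k) (k ! ℕ.* d !) ⟩
    ((k ℕ.+ d) C k) ℕ.* suc (k ℕ.+ d) ℕ.* (k ! ℕ.* d !)    ∎
  where
  swap : ∀ x y z → x ℕ.* (y ℕ.* z) ≡ y ℕ.* x ℕ.* z
  swap = ℕ-Solver.solve-∀

cancel-!*! : ∀ k d {x y} → x ℕ.* (k ! ℕ.* d !) ≡ y ℕ.* (k ! ℕ.* d !) → x ≡ y
cancel-!*! k d = ℕₚ.*-cancelʳ-≡ _ _ (k ! ℕ.* d !) {{ℕₚ._!*_!≢0 k d}}

C-suc : ∀ k d → (suc (k ℕ.+ d) C k) ℕ.* suc d ≡ ((k ℕ.+ d) C k) ℕ.* suc (k ℕ.+ d)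
C-suc k d = cancel-!*! k d (begin
    (suc (k ℕ.+ d) C k) ℕ.* suc d ℕ.* (k ! ℕ.* d !)   ≡⟨ shuffle (suc (k ℕ.+ d) C k) (suc d) (k !) (d !) ⟩
    (suc (k ℕ.+ d) C k) ℕ.* (k ! ℕ.* suc d !)         ≡⟨ subst (λ n → (n C k) ℕ.* (k ! ℕ.* suc d !) ≡ n !)
                                                               (ℕₚ.+-suc k d) (C*!*!≡! k (suc d)) ⟩
    suc (k ℕ.+ d) !                                    ≡⟨ suc-C*!*! k d ⟩
    ((k ℕ.+ d) C k) ℕ.* suc (k ℕ.+ d) ℕ.* (k ! ℕ.* d !) ∎)
  where
  shuffle : ∀ c x y z → c ℕ.* x ℕ.* (y ℕ.* z) ≡ c ℕ.* (y ℕ.* (x ℕ.* z))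
  shuffle = ℕ-Solver.solve-∀

C-shift : ∀ j d → ((2 ℕ.+ (j ℕ.+ d)) C j) ℕ.* (suc d ℕ.* (2 ℕ.+ d))
                    ≡ (2 ℕ.+ (j ℕ.+ d)) ℕ.* (suc j ℕ.* (suc (j ℕ.+ d) C suc j))
C-shift j d = cancel-!*! j d (begin
    ((2 ℕ.+ (j ℕ.+ d)) C j) ℕ.* (suc d ℕ.* (2 ℕ.+ d)) ℕ.* (j ! ℕ.* d !)
      ≡⟨ shuffle ((2 ℕ.+ (j ℕ.+ d)) C j) (suc d) (2 ℕ.+ d) (j !) (d !) ⟩
    ((2 ℕ.+ (j ℕ.+ d)) C j) ℕ.* (j ! ℕ.* (2 ℕ.+ d) !)
      ≡⟨ subst (λ n → (n C j) ℕ.* (j ! ℕ.* (2 ℕ.+ d) !) ≡ n !) j+[2+d]≡2+[j+d] (C*!*!≡! j (2 ℕ.+ d)) ⟩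
    (2 ℕ.+ (j ℕ.+ d)) !
      ≡⟨ cong ((2 ℕ.+ (j ℕ.+ d)) ℕ.*_) (C*!*!≡! (suc j) d) ⟨
    (2 ℕ.+ (j ℕ.+ d)) ℕ.* ((suc (j ℕ.+ d) C suc j) ℕ.* (suc j ! ℕ.* d !))
      ≡⟨ shuffle′ (2 ℕ.+ (j ℕ.+ d)) (suc j) (suc (j ℕ.+ d) C suc j) (j !) (d !) ⟩
    (2 ℕ.+ (j ℕ.+ d)) ℕ.* (suc j ℕ.* (suc (j ℕ.+ d) C suc j)) ℕ.* (j ! ℕ.* d !) ∎)
  where
  j+[2+d]≡2+[j+d] : j ℕ.+ (2 ℕ.+ d) ≡ 2 ℕ.+ (j ℕ.+ d)
  j+[2+d]≡2+[j+d] = trans (ℕₚ.+-suc j (suc d)) (cong suc (ℕₚ.+-suc j d))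

  shuffle : ∀ c x y p q → c ℕ.* (x ℕ.* y) ℕ.* (p ℕ.* q) ≡ c ℕ.* (p ℕ.* (y ℕ.* (x ℕ.* q)))
  shuffle = ℕ-Solver.solve-∀

  shuffle′ : ∀ z y c p q → z ℕ.* (c ℕ.* (y ℕ.* p ℕ.* q)) ≡ z ℕ.* (y ℕ.* c) ℕ.* (p ℕ.* q)
  shuffle′ = ℕ-Solver.solve-∀

[1+n]Cn≡1+n : ∀ n → suc n C n ≡ suc n
[1+n]Cn≡1+n n = begin
    suc n C n             ≡⟨ nCk≡nC[n∸k] (ℕₚ.n≤1+n n) ⟩
    suc n C (suc n ℕ.∸ n) ≡⟨ cong (suc n C_) (ℕₚ.m+n∸n≡m 1 n) ⟩
    suc n C 1             ≡⟨ nC1≡n (suc n) ⟩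
    suc n                 ∎

ι-C-suc : ∀ k d → ι (suc (k ℕ.+ d) C k) * (ι d + 1ℚ) ≡ ι ((k ℕ.+ d) C k) * (ι (k ℕ.+ d) + 1ℚ)
ι-C-suc k d = subst₂ (λ x y → ι (suc (k ℕ.+ d) C k) * x ≡ ι ((k ℕ.+ d) C k) * y) (ι-suc d) (ι-suc (k ℕ.+ d))
  (ι-*-cong (suc (k ℕ.+ d) C k) (suc d) ((k ℕ.+ d) C k) (suc (k ℕ.+ d)) (C-suc k d))

ι-C-suc₂ : ∀ k d → ι ((2 ℕ.+ (k ℕ.+ d)) C k) * (ι d + 1ℚ + 1ℚ) ≡ ι (suc (k ℕ.+ d) C k) * (ι (k ℕ.+ d) + 1ℚ + 1ℚ)
ι-C-suc₂ k d = subst₂ (λ x y → ι ((2 ℕ.+ (k ℕ.+ d)) C k) * x ≡ ι (suc (k ℕ.+ d) C k) * y) (ι-2+ d) (ι-2+ (k ℕ.+ d))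
  (ι-*-cong ((2 ℕ.+ (k ℕ.+ d)) C k) (2 ℕ.+ d) (suc (k ℕ.+ d) C k) (2 ℕ.+ (k ℕ.+ d))
    (subst (λ n → (suc n C k) ℕ.* (2 ℕ.+ d) ≡ (n C k) ℕ.* suc n) (ℕₚ.+-suc k d) (C-suc k (suc d))))

ι-C-shift : ∀ j d → ι ((2 ℕ.+ (j ℕ.+ d)) C j) * ((ι d + 1ℚ) * (ι d + 1ℚ + 1ℚ))
                     ≡ (ι (suc (j ℕ.+ d)) + 1ℚ) * (ι (suc j) * ι (suc (j ℕ.+ d) C suc j))
ι-C-shift j d = begin
    ι c * ((ι d + 1ℚ) * (ι d + 1ℚ + 1ℚ))        ≡⟨ cong (ι c *_) (cong₂ _*_ (ι-suc d) (ι-2+ d)) ⟨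
    ι c * (ι (suc d) * ι (2 ℕ.+ d))              ≡⟨ cong (ι c *_) (ι-* (suc d) (2 ℕ.+ d)) ⟨
    ι c * ι (suc d ℕ.* (2 ℕ.+ d))                ≡⟨ ι-* c (suc d ℕ.* (2 ℕ.+ d)) ⟨
    ι (c ℕ.* (suc d ℕ.* (2 ℕ.+ d)))              ≡⟨ cong ι (C-shift j d) ⟩
    ι ((2 ℕ.+ (j ℕ.+ d)) ℕ.* (suc j ℕ.* c′))     ≡⟨ ι-* (2 ℕ.+ (j ℕ.+ d)) (suc j ℕ.* c′) ⟩
    ι (2 ℕ.+ (j ℕ.+ d)) * ι (suc j ℕ.* c′)       ≡⟨ cong₂ _*_ (ι-suc (suc (j ℕ.+ d))) (ι-* (suc j) c′) ⟩
    (ι (suc (j ℕ.+ d)) + 1ℚ) * (ι (suc j) * ι c′) ∎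
  where
  c = (2 ℕ.+ (j ℕ.+ d)) C j
  c′ = suc (j ℕ.+ d) C suc j

rise-+ : ∀ x m n → rise x (m ℕ.+ n) ≡ rise x m * rise (x + ι m) n
rise-+ x m zero = trans (cong (rise x) (ℕₚ.+-identityʳ m)) (sym (ℚ.*-identityʳ (rise x m)))
rise-+ x m (suc n) = begin
    rise x (m ℕ.+ suc n)                              ≡⟨ cong (rise x) (ℕₚ.+-suc m n) ⟩
    rise x (m ℕ.+ n) * (x + ι (m ℕ.+ n))              ≡⟨ cong₂ (λ y z → y * (x + z)) (rise-+ x m n) (ι-+ m n) ⟩
    rise x m * rise (x + ι m) n * (x + (ι m + ι n))   ≡⟨ reassoc (rise x m) (rise (x + ι m) n) x (ι m) (ι n) ⟩
    rise x m * (rise (x + ι m) n * (x + ι m + ι n))   ∎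
  where
  reassoc : ∀ a b y u w → a * b * (y + (u + w)) ≡ a * (b * (y + u + w))
  reassoc = solve-∀ ℚ-ring

rise≢0-mono : ∀ {x m n} → m ≤ n → rise x n ≢ 0ℚ → rise x m ≢ 0ℚ
rise≢0-mono {x} {m} {n} m≤n x↑n≢0 = *-≢0ˡ (rise (x + ι m) (n ℕ.∸ m))
  (subst (_≢ 0ℚ) (trans (cong (rise x) (sym (ℕₚ.m+[n∸m]≡n m≤n))) (rise-+ x m (n ℕ.∸ m))) x↑n≢0)

rise≢0⇒+ι≢0 : ∀ {x j n} → j < n → rise x n ≢ 0ℚ → x + ι j ≢ 0ℚ
rise≢0⇒+ι≢0 {x} {j} j<n x↑n≢0 = *-≢0ʳ (rise x j) (rise≢0-mono j<n x↑n≢0)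

Σ≤-cong : ∀ n {f g : ℕ → ℚ} → (∀ {i} → i ≤ n → f i ≡ g i) → Σ≤ n f ≡ Σ≤ n g
Σ≤-cong zero    eq = eq z≤n
Σ≤-cong (suc n) eq = cong₂ _+_ (Σ≤-cong n (λ i≤n → eq (ℕₚ.m≤n⇒m≤1+n i≤n))) (eq ℕₚ.≤-refl)

*-distribˡ-Σ≤ : ∀ n c (f : ℕ → ℚ) → c * Σ≤ n f ≡ Σ≤ n (λ i → c * f i)
*-distribˡ-Σ≤ zero    c f = refl
*-distribˡ-Σ≤ (suc n) c f = trans (ℚ.*-distribˡ-+ c (Σ≤ n f) (f (suc n))) (cong (_+ c * f (suc n)) (*-distribˡ-Σ≤ n c f))

Σ≤-linear : ∀ n c d (f g : ℕ → ℚ) → Σ≤ n (λ i → c * f i - d * g i) ≡ c * Σ≤ n f - d * Σ≤ n g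
Σ≤-linear zero    c d f g = refl
Σ≤-linear (suc n) c d f g = trans (cong (_+ (c * f (suc n) - d * g (suc n))) (Σ≤-linear n c d f g))
                                  (regroup c d (Σ≤ n f) (Σ≤ n g) (f (suc n)) (g (suc n)))
  where
  regroup : ∀ c d x y u w → c * x - d * y + (c * u - d * w) ≡ c * (x + u) - d * (y + w)
  regroup = solve-∀ ℚ-ring

Σ≤-telescope : ∀ n (f g : ℕ → ℚ) → (∀ {i} → i ≤ n → f i ≡ g (suc i) - g i) → Σ≤ n f ≡ g (suc n) - g 0
Σ≤-telescope zero    f g eq = eq z≤n
Σ≤-telescope (suc n) f g eq = begin
    Σ≤ n f + f (suc n)                                  ≡⟨ cong₂ _+_ (Σ≤-telescope n f g (λ i≤n → eq (ℕₚ.m≤n⇒m≤1+n i≤n)))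
                                                                     (eq ℕₚ.≤-refl) ⟩
    g (suc n) - g 0 + (g (suc (suc n)) - g (suc n))     ≡⟨ collapse (g (suc (suc n))) (g (suc n)) (g 0) ⟩
    g (suc (suc n)) - g 0                               ∎
  where
  collapse : ∀ x y z → y - z + (x - y) ≡ x - z
  collapse = solve-∀ ℚ-ring

Σ≤-creative-telescoping : ∀ n c₂ c₀ (f₂ f₀ g : ℕ → ℚ) → g 0 ≡ 0ℚ →
  (∀ {i} → i ≤ n → c₂ * f₂ i - c₀ * f₀ i ≡ g (suc i) - g i) →
  g (suc n) ≡ - (c₂ * (f₂ (suc n) + f₂ (suc (suc n)))) →
  c₂ * Σ≤ (suc (suc n)) f₂ ≡ c₀ * Σ≤ n f₀
Σ≤-creative-telescoping n c₂ c₀ f₂ f₀ g g0≡0 step top =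
  close c₂ c₀ (Σ≤ n f₂) (Σ≤ n f₀) (f₂ (suc n)) (f₂ (suc (suc n))) (g (suc n)) (g 0) telescoped g0≡0 top
  where
  telescoped : c₂ * Σ≤ n f₂ - c₀ * Σ≤ n f₀ ≡ g (suc n) - g 0
  telescoped = trans (sym (Σ≤-linear n c₂ c₀ f₂ f₀)) (Σ≤-telescope n (λ i → c₂ * f₂ i - c₀ * f₀ i) g step)

  close : ∀ c₂ c₀ x y a b e z → c₂ * x - c₀ * y ≡ e - z → z ≡ 0ℚ → e ≡ - (c₂ * (a + b)) →
          c₂ * (x + a + b) ≡ c₀ * y
  close c₂ c₀ x y a b e z eq refl refl = begin
      c₂ * (x + a + b)                               ≡⟨ solve (c₂ ∷ c₀ ∷ x ∷ y ∷ a ∷ b ∷ []) ℚ-ring ⟩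
      (c₂ * x - c₀ * y) + c₂ * (a + b) + c₀ * y      ≡⟨ cong (λ w → w + c₂ * (a + b) + c₀ * y) eq ⟩
      (- (c₂ * (a + b)) - 0ℚ) + c₂ * (a + b) + c₀ * y ≡⟨ solve (c₂ ∷ a ∷ b ∷ y ∷ c₀ ∷ []) ℚ-ring ⟩
      c₀ * y                                          ∎

-- Here f, g₁ and g₀ are x times k / (m₁ m₂), u₁ / m₁ and u₀ / (m₁ m₂), so the
-- telescoping relation amounts to the polynomial identity in the last hypothesis.
cleared-telescoping : ∀ c₂ c₀ x f g₁ g₀ m₁ m₂ k u₁ u₀ → m₁ * m₂ ≢ 0ℚ →
  f * (m₁ * m₂) ≡ x * k → g₁ * m₁ ≡ x * u₁ → g₀ * (m₁ * m₂) ≡ x * u₀ →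
  c₂ * k - c₀ * (m₁ * m₂) ≡ u₁ * m₂ - u₀ →
  c₂ * f - c₀ * x ≡ g₁ - g₀
cleared-telescoping c₂ c₀ x f g₁ g₀ m₁ m₂ k u₁ u₀ m≢0 hf h₁ h₀ identity = *-cancelʳ (m₁ * m₂) m≢0 (begin
    (c₂ * f - c₀ * x) * (m₁ * m₂)           ≡⟨ solve (c₂ ∷ c₀ ∷ x ∷ f ∷ m₁ ∷ m₂ ∷ []) ℚ-ring ⟩
    c₂ * (f * (m₁ * m₂)) - c₀ * x * (m₁ * m₂) ≡⟨ cong (λ y → c₂ * y - c₀ * x * (m₁ * m₂)) hf ⟩
    c₂ * (x * k) - c₀ * x * (m₁ * m₂)       ≡⟨ solve (c₂ ∷ c₀ ∷ x ∷ k ∷ m₁ ∷ m₂ ∷ []) ℚ-ring ⟩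
    x * (c₂ * k - c₀ * (m₁ * m₂))           ≡⟨ cong (x *_) identity ⟩
    x * (u₁ * m₂ - u₀)                      ≡⟨ solve (x ∷ u₁ ∷ m₂ ∷ u₀ ∷ []) ℚ-ring ⟩
    x * u₁ * m₂ - x * u₀                    ≡⟨ cong₂ (λ y z → y * m₂ - z) h₁ h₀ ⟨
    g₁ * m₁ * m₂ - g₀ * (m₁ * m₂)           ≡⟨ solve (g₁ ∷ g₀ ∷ m₁ ∷ m₂ ∷ []) ℚ-ring ⟩
    (g₁ - g₀) * (m₁ * m₂)                   ∎)

-- Q is the polynomial part of the certificate G of Zeilberger's algorithm for
-- Dixon's sum. It is a record field rather than a definition so that, while the
-- two identities are checked, the ring solver sees its defining polynomial.
record DixonCertificate : Set where
  field
    Q : ℚ → ℚ → ℚ → ℚ → ℚ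
    Q-telescopes : ∀ A B I D R I₁ → R ≡ I + D → I₁ ≡ I + 1ℚ →
      (B + R) * (B + R + 1ℚ) * (ι 2 * B + R) * (((R + 1ℚ) * (R + 1ℚ + 1ℚ)) * ((A + D) * (A + (D + 1ℚ))))
        - (R + 1ℚ) * (ι 2 * B - ι 2 * A + R) * (ι 2 * A + R) * (((D + 1ℚ) * (B + D)) * ((D + 1ℚ + 1ℚ) * (B + (D + 1ℚ))))
      ≡ (- ((R + 1ℚ) * (A + I)) * Q A B R I₁) * ((D + 1ℚ + 1ℚ) * (B + (D + 1ℚ)))
        - (R + 1ℚ) * I * (A + D) * (B + I - 1ℚ) * Q A B R I
    Q-boundary : ∀ A B R R₁ → R₁ ≡ R + 1ℚ →
      (B + R) * (B + R + 1ℚ) * Q A B R R₁ ≡ - ((B + R) * (B + R + 1ℚ) * (ι 2 * B + R) * (A * (B + R + ι 2) - B))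

certificate : DixonCertificate
certificate = record
  { Q = λ A B R x →
      - ι 2 * R * R * R - (ι 4 + ι 2 * B + ι 5 * A) * R * R - (ι 2 + B + ι 10 * A + ι 7 * A * B) * R
        + ι 2 * B * B - ι 4 * A - ι 8 * A * B - ι 2 * A * B * B
        + (ι 3 * R * (R + 1ℚ) + ι 2 * B * R + ι 6 * A * (R + 1ℚ) + ι 4 * A * B) * x
        - (R + ι 2 * A) * x * x
  ; Q-telescopes = λ { A B I D _ _ refl refl → solve (A ∷ B ∷ I ∷ D ∷ []) ℚ-ring }
  ; Q-boundary = λ { A B R _ refl → solve (A ∷ B ∷ R ∷ []) ℚ-ring }
  }

open DixonCertificate certificate

-- Dixon's well-poised sum

module Dixon (A B : ℚ) where

  t : ℕ → ℚ
  t n = rise A n ⊘ rise B n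

  -- f and g take e = r − i (resp. r − j) as a separate argument, so that index
  -- identities such as (i + d) ∸ i ≡ d can be applied by cong.
  f : ℕ → ℕ → ℕ → ℚ
  f r i e = sgn i * ι (r C i) * t i * t e

  term : ℕ → ℕ → ℚ
  term r i = f r i (r ℕ.∸ i)

  S : ℕ → ℚ
  S r = Σ≤ r (term r)

  c₂ c₀ : ℚ → ℚ
  c₂ R = (B + R) * (B + R + 1ℚ) * (ι 2 * B + R)
  c₀ R = (R + 1ℚ) * (ι 2 * B - ι 2 * A + R) * (ι 2 * A + R)

  g : ℕ → ℕ → ℕ → ℚ
  g r j e = (sgn (suc j) * ι (suc r C j) * t (suc j) * t e * (B + ι j) * Q A B (ι r) (ι (suc j))) ⊘ (B + ι e)

  G : ℕ → ℕ → ℚ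
  G r zero    = 0ℚ
  G r (suc j) = g r j (r ℕ.∸ j)

  -- For D = ι (r − i) and R = ι r, κ D R / (m₁ D · m₂ D) is the ratio of term (r + 2) i
  -- to term r i, and m₁ D · m₂ D clears the denominators of G r i and G r (i + 1)
  -- relative to term r i.
  m₁ m₂ : ℚ → ℚ
  m₁ D = (D + 1ℚ) * (B + D)
  m₂ D = (D + 1ℚ + 1ℚ) * (B + (D + 1ℚ))

  κ : ℚ → ℚ → ℚ
  κ D R = ((R + 1ℚ) * (R + 1ℚ + 1ℚ)) * ((A + D) * (A + (D + 1ℚ)))

  g-cleared : ∀ r j e → B + ι e ≢ 0ℚ →
    g r j e * (B + ι e) ≡ sgn (suc j) * ι (suc r C j) * t (suc j) * t e * (B + ι j) * Q A B (ι r) (ι (suc j))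
  g-cleared r j e = p⊘q*q≡p _

  t-suc : ∀ n → rise B (suc n) ≢ 0ℚ → t (suc n) * (B + ι n) ≡ t n * (A + ι n)
  t-suc n B↑ = *-cancelʳ (rise B n) B↑n≢0 (begin
      t (suc n) * (B + ι n) * rise B n  ≡⟨ xy∙z≈x∙zy (t (suc n)) (B + ι n) (rise B n) ⟩
      t (suc n) * rise B (suc n)        ≡⟨ p⊘q*q≡p (rise A (suc n)) B↑ ⟩
      rise A n * (A + ι n)              ≡⟨ cong (_* (A + ι n)) (p⊘q*q≡p (rise A n) B↑n≢0) ⟨
      t n * rise B n * (A + ι n)        ≡⟨ xy∙z≈xz∙y (t n) (rise B n) (A + ι n) ⟩
      t n * (A + ι n) * rise B n        ∎)
    where B↑n≢0 = *-≢0ˡ (B + ι n) B↑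

  t-suc₂ : ∀ n → rise B (2 ℕ.+ n) ≢ 0ℚ → t (2 ℕ.+ n) * (B + (ι n + 1ℚ)) ≡ t (suc n) * (A + (ι n + 1ℚ))
  t-suc₂ n B↑ = subst (λ x → t (2 ℕ.+ n) * (B + x) ≡ t (suc n) * (A + x)) (ι-suc n) (t-suc (suc n) B↑)

  module _ (i d : ℕ) (B↑ : rise B (2 ℕ.+ (i ℕ.+ d)) ≢ 0ℚ) where

    private
      r = i ℕ.+ d
      I = ι i
      D = ι d
      R = ι r

      d≤r : d ≤ r
      d≤r = ℕₚ.m≤n+m d i

      d<2+r : d < 2 ℕ.+ r
      d<2+r = s≤s (ℕₚ.m≤n⇒m≤1+n d≤r)

      B+D≢0 : B + D ≢ 0ℚ
      B+D≢0 = rise≢0⇒+ι≢0 d<2+r B↑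

    m₁*m₂≢0 : m₁ D * m₂ D ≢ 0ℚ
    m₁*m₂≢0 = *-≢0 (*-≢0 (subst (_≢ 0ℚ) (ι-suc d) (ι-suc≢0 d)) B+D≢0)
                   (*-≢0 (subst (_≢ 0ℚ) (ι-2+ d) (ι-suc≢0 (suc d)))
                         (subst (λ x → B + x ≢ 0ℚ) (ι-suc d) (rise≢0⇒+ι≢0 (s≤s (s≤s d≤r)) B↑)))

    term-ratio : term (2 ℕ.+ r) i * (m₁ D * m₂ D) ≡ term r i * κ D R
    term-ratio = begin
        term (2 ℕ.+ r) i * (m₁ D * m₂ D)        ≡⟨ cong (λ e → f (2 ℕ.+ r) i e * (m₁ D * m₂ D)) [2+r]∸i≡2+d ⟩
        f (2 ℕ.+ r) i (2 ℕ.+ d) * (m₁ D * m₂ D)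
          ≡⟨ shift (sgn i) (ι (r C i)) (ι (suc r C i)) (ι ((2 ℕ.+ r) C i)) (t i) (t d) (t (suc d)) (t (2 ℕ.+ d)) D R
               (ι-C-suc i d) (ι-C-suc₂ i d) (t-suc d (rise≢0-mono d<2+r B↑)) (t-suc₂ d (rise≢0-mono (s≤s (s≤s d≤r)) B↑)) ⟩
        f r i d * κ D R                          ≡⟨ cong (λ e → f r i e * κ D R) (ℕₚ.m+n∸m≡n i d) ⟨
        term r i * κ D R                         ∎
      where
      [2+r]∸i≡2+d : 2 ℕ.+ r ℕ.∸ i ≡ 2 ℕ.+ d
      [2+r]∸i≡2+d = trans (ℕₚ.+-∸-assoc 2 (ℕₚ.m≤m+n i d)) (cong (2 ℕ.+_) (ℕₚ.m+n∸m≡n i d))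

      -- stated over variables: the ring solver only abstracts variables, so the
      -- atoms t i, ι (r C i), … have to be generalised
      shift : ∀ s c c₁ c₂ w u u₁ u₂ D R →
        c₁ * (D + 1ℚ) ≡ c * (R + 1ℚ) → c₂ * (D + 1ℚ + 1ℚ) ≡ c₁ * (R + 1ℚ + 1ℚ) →
        u₁ * (B + D) ≡ u * (A + D) → u₂ * (B + (D + 1ℚ)) ≡ u₁ * (A + (D + 1ℚ)) →
        s * c₂ * w * u₂ * (((D + 1ℚ) * (B + D)) * ((D + 1ℚ + 1ℚ) * (B + (D + 1ℚ))))
          ≡ s * c * w * u * (((R + 1ℚ) * (R + 1ℚ + 1ℚ)) * ((A + D) * (A + (D + 1ℚ))))
      shift s c c₁ c₂ w u u₁ u₂ D R hc₁ hc₂ hu₁ hu₂ = begin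
          s * c₂ * w * u₂ * (((D + 1ℚ) * (B + D)) * ((D + 1ℚ + 1ℚ) * (B + (D + 1ℚ))))
            ≡⟨ solve (s ∷ c₂ ∷ w ∷ u₂ ∷ D ∷ B ∷ []) ℚ-ring ⟩
          s * w * (D + 1ℚ) * (B + D) * (c₂ * (D + 1ℚ + 1ℚ)) * (u₂ * (B + (D + 1ℚ)))
            ≡⟨ cong₂ (λ x y → s * w * (D + 1ℚ) * (B + D) * x * y) hc₂ hu₂ ⟩
          s * w * (D + 1ℚ) * (B + D) * (c₁ * (R + 1ℚ + 1ℚ)) * (u₁ * (A + (D + 1ℚ)))
            ≡⟨ solve (s ∷ w ∷ D ∷ B ∷ c₁ ∷ R ∷ u₁ ∷ A ∷ []) ℚ-ring ⟩
          s * w * (R + 1ℚ + 1ℚ) * (A + (D + 1ℚ)) * (c₁ * (D + 1ℚ)) * (u₁ * (B + D))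
            ≡⟨ cong₂ (λ x y → s * w * (R + 1ℚ + 1ℚ) * (A + (D + 1ℚ)) * x * y) hc₁ hu₁ ⟩
          s * w * (R + 1ℚ + 1ℚ) * (A + (D + 1ℚ)) * (c * (R + 1ℚ)) * (u * (A + D))
            ≡⟨ solve (s ∷ w ∷ R ∷ A ∷ D ∷ c ∷ u ∷ []) ℚ-ring ⟩
          s * c * w * u * (((R + 1ℚ) * (R + 1ℚ + 1ℚ)) * ((A + D) * (A + (D + 1ℚ)))) ∎

    G-suc-ratio : G r (suc i) * m₁ D ≡ term r i * (- ((R + 1ℚ) * (A + I)) * Q A B R (ι (suc i)))
    G-suc-ratio = begin
        G r (suc i) * m₁ D       ≡⟨ cong (λ e → g r i e * m₁ D) (ℕₚ.m+n∸m≡n i d) ⟩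
        g r i d * m₁ D
          ≡⟨ upper (sgn i) (ι (r C i)) (ι (suc r C i)) (t i) (t (suc i)) (t d) (Q A B R (ι (suc i))) (g r i d) I D R
               (g-cleared r i d B+D≢0) (ι-C-suc i d) (t-suc i (rise≢0-mono 1+i≤2+r B↑)) ⟩
        f r i d * u              ≡⟨ cong (λ e → f r i e * u) (ℕₚ.m+n∸m≡n i d) ⟨
        term r i * u             ∎
      where
      u = - ((R + 1ℚ) * (A + I)) * Q A B R (ι (suc i))

      1+i≤2+r : suc i ≤ 2 ℕ.+ r
      1+i≤2+r = s≤s (ℕₚ.m≤n⇒m≤1+n (ℕₚ.m≤m+n i d))

      upper : ∀ s c c₁ w w₁ u q x I D R →
        x * (B + D) ≡ (- s) * c₁ * w₁ * u * (B + I) * q →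
        c₁ * (D + 1ℚ) ≡ c * (R + 1ℚ) → w₁ * (B + I) ≡ w * (A + I) →
        x * ((D + 1ℚ) * (B + D)) ≡ s * c * w * u * (- ((R + 1ℚ) * (A + I)) * q)
      upper s c c₁ w w₁ u q x I D R hx hc hw = begin
          x * ((D + 1ℚ) * (B + D))                         ≡⟨ solve (x ∷ D ∷ B ∷ []) ℚ-ring ⟩
          x * (B + D) * (D + 1ℚ)                           ≡⟨ cong (_* (D + 1ℚ)) hx ⟩
          (- s) * c₁ * w₁ * u * (B + I) * q * (D + 1ℚ)     ≡⟨ solve (s ∷ c₁ ∷ w₁ ∷ u ∷ B ∷ I ∷ q ∷ D ∷ []) ℚ-ring ⟩
          (- s) * u * q * (c₁ * (D + 1ℚ)) * (w₁ * (B + I)) ≡⟨ cong₂ (λ y z → (- s) * u * q * y * z) hc hw ⟩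
          (- s) * u * q * (c * (R + 1ℚ)) * (w * (A + I))   ≡⟨ solve (s ∷ u ∷ q ∷ c ∷ R ∷ w ∷ A ∷ I ∷ []) ℚ-ring ⟩
          s * c * w * u * (- ((R + 1ℚ) * (A + I)) * q)     ∎

  module _ (j d : ℕ) (B↑ : rise B (2 ℕ.+ (suc j ℕ.+ d)) ≢ 0ℚ) where

    private
      r = suc j ℕ.+ d
      I = ι (suc j)
      D = ι d
      R = ι r

    G-ratio-suc : G r (suc j) * (m₁ D * m₂ D) ≡ term r (suc j) * ((R + 1ℚ) * I * (A + D) * (B + I - 1ℚ) * Q A B R I)
    G-ratio-suc = begin
        G r (suc j) * (m₁ D * m₂ D)     ≡⟨ cong (λ e → g r j e * (m₁ D * m₂ D)) r∸j≡1+d ⟩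
        g r j (suc d) * (m₁ D * m₂ D)
          ≡⟨ lower (sgn (suc j)) (ι (r C suc j)) (ι (suc r C j)) (t (suc j)) (t d) (t (suc d)) (Q A B R I) (g r j (suc d))
               I (ι j) D (ι (suc d)) R (ι-suc j) (ι-suc d)
               (g-cleared r j (suc d) (rise≢0⇒+ι≢0 1+d<2+r B↑)) (ι-C-shift j d) (t-suc d (rise≢0-mono (ℕₚ.<⇒≤ 1+d<2+r) B↑)) ⟩
        f r (suc j) d * u               ≡⟨ cong (λ e → f r (suc j) e * u) (ℕₚ.m+n∸m≡n j d) ⟨
        term r (suc j) * u              ∎
      where
      u = (R + 1ℚ) * I * (A + D) * (B + I - 1ℚ) * Q A B R I

      r∸j≡1+d : r ℕ.∸ j ≡ suc d
      r∸j≡1+d = trans (ℕₚ.+-∸-assoc 1 (ℕₚ.m≤m+n j d)) (cong suc (ℕₚ.m+n∸m≡n j d))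

      1+d<2+r : suc d < 2 ℕ.+ r
      1+d<2+r = s≤s (s≤s (ℕₚ.m≤n⇒m≤1+n (ℕₚ.m≤n+m d j)))

      lower : ∀ s c c₂ w u u₁ q x I J D D₁ R → I ≡ J + 1ℚ → D₁ ≡ D + 1ℚ →
        x * (B + D₁) ≡ s * c₂ * w * u₁ * (B + J) * q →
        c₂ * ((D + 1ℚ) * (D + 1ℚ + 1ℚ)) ≡ (R + 1ℚ) * (I * c) →
        u₁ * (B + D) ≡ u * (A + D) →
        x * (((D + 1ℚ) * (B + D)) * ((D + 1ℚ + 1ℚ) * (B + (D + 1ℚ))))
          ≡ s * c * w * u * ((R + 1ℚ) * I * (A + D) * (B + I - 1ℚ) * q)
      lower s c c₂ w u u₁ q x _ J D _ R refl refl hx hc hu = begin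
          x * (((D + 1ℚ) * (B + D)) * ((D + 1ℚ + 1ℚ) * (B + (D + 1ℚ))))
            ≡⟨ solve (x ∷ D ∷ B ∷ []) ℚ-ring ⟩
          x * (B + (D + 1ℚ)) * (B + D) * ((D + 1ℚ) * (D + 1ℚ + 1ℚ))
            ≡⟨ cong (λ y → y * (B + D) * ((D + 1ℚ) * (D + 1ℚ + 1ℚ))) hx ⟩
          s * c₂ * w * u₁ * (B + J) * q * (B + D) * ((D + 1ℚ) * (D + 1ℚ + 1ℚ))
            ≡⟨ solve (s ∷ c₂ ∷ w ∷ u₁ ∷ B ∷ J ∷ q ∷ D ∷ []) ℚ-ring ⟩
          s * w * (B + J) * q * (c₂ * ((D + 1ℚ) * (D + 1ℚ + 1ℚ))) * (u₁ * (B + D))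
            ≡⟨ cong₂ (λ y z → s * w * (B + J) * q * y * z) hc hu ⟩
          s * w * (B + J) * q * ((R + 1ℚ) * ((J + 1ℚ) * c)) * (u * (A + D))
            ≡⟨ solve (s ∷ w ∷ B ∷ J ∷ q ∷ R ∷ c ∷ u ∷ A ∷ D ∷ []) ℚ-ring ⟩
          s * c * w * u * ((R + 1ℚ) * (J + 1ℚ) * (A + D) * (B + (J + 1ℚ) - 1ℚ) * q) ∎

  G-ratio : ∀ i d → rise B (2 ℕ.+ (i ℕ.+ d)) ≢ 0ℚ → let D = ι d ; R = ι (i ℕ.+ d) in
    G (i ℕ.+ d) i * (m₁ D * m₂ D) ≡ term (i ℕ.+ d) i * ((R + 1ℚ) * ι i * (A + D) * (B + ι i - 1ℚ) * Q A B R (ι i))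
  G-ratio zero    d _  = vanish (term d 0) (m₁ (ι d) * m₂ (ι d)) (ι d + 1ℚ) (A + ι d) (B + 0ℚ - 1ℚ) (Q A B (ι d) 0ℚ)
    where
    vanish : ∀ x m a b c q → 0ℚ * m ≡ x * (a * 0ℚ * b * c * q)
    vanish = solve-∀ ℚ-ring
  G-ratio (suc j) d B↑ = G-ratio-suc j d B↑

  telescopes : ∀ {r i} → i ≤ r → rise B (2 ℕ.+ r) ≢ 0ℚ →
    c₂ (ι r) * term (2 ℕ.+ r) i - c₀ (ι r) * term r i ≡ G r (suc i) - G r i
  telescopes {i = i} i≤r B↑ with ℕₚ.m≤n⇒∃[o]m+o≡n i≤r
  ... | d , refl = cleared-telescoping (c₂ R) (c₀ R) (term r i) (term (2 ℕ.+ r) i) (G r (suc i)) (G r i)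
      (m₁ D) (m₂ D) (κ D R)
      (- ((R + 1ℚ) * (A + I)) * Q A B R (ι (suc i)))
      ((R + 1ℚ) * I * (A + D) * (B + I - 1ℚ) * Q A B R I)
      (m₁*m₂≢0 i d B↑) (term-ratio i d B↑) (G-suc-ratio i d B↑) (G-ratio i d B↑)
      (Q-telescopes A B I D R (ι (suc i)) (ι-+ i d) (ι-suc i))
    where
    r = i ℕ.+ d
    I = ι i
    D = ι d
    R = ι r

  G-boundary : ∀ r → rise B (2 ℕ.+ r) ≢ 0ℚ →
    G r (suc r) ≡ - (c₂ (ι r) * (term (2 ℕ.+ r) (suc r) + term (2 ℕ.+ r) (2 ℕ.+ r)))
  G-boundary r B↑ = begin
      G r (suc r)        ≡⟨ cong (g r r) (ℕₚ.n∸n≡0 r) ⟩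
      g r r 0
        ≡⟨ top (sgn (suc r)) R (ι (suc r)) (ι (2 ℕ.+ r)) (c₂ R) (t 1) (t (suc r)) (t (2 ℕ.+ r)) (Q A B R (ι (suc r))) (g r r 0)
             (ι-suc r) (ι-suc (suc r))
             (trans (g-cleared r r 0 (rise≢0⇒+ι≢0 0<2+r B↑))
                    (cong (λ c → sgn (suc r) * ι c * t (suc r) * t 0 * (B + ι r) * Q A B R (ι (suc r))) ([1+n]Cn≡1+n r)))
             (t-suc 0 (rise≢0-mono 0<2+r B↑)) (t-suc (suc r) B↑)
             (Q-boundary A B R (ι (suc r)) (ι-suc r))
             (*-≢0 (rise≢0⇒+ι≢0 0<2+r B↑) (rise≢0⇒+ι≢0 1+r<2+r B↑)) ⟩
      - (c₂ R * (sgn (suc r) * ι (2 ℕ.+ r) * t (suc r) * t 1 + (- sgn (suc r)) * 1ℚ * t (2 ℕ.+ r) * 1ℚ))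
        ≡⟨ cong₂ (λ x y → - (c₂ R * (x + y))) top-left top-right ⟨
      - (c₂ R * (term (2 ℕ.+ r) (suc r) + term (2 ℕ.+ r) (2 ℕ.+ r))) ∎
    where
    R = ι r

    0<2+r : 0 < 2 ℕ.+ r
    0<2+r = s≤s z≤n

    1+r<2+r : suc r < 2 ℕ.+ r
    1+r<2+r = ℕₚ.≤-refl

    top-left : term (2 ℕ.+ r) (suc r) ≡ sgn (suc r) * ι (2 ℕ.+ r) * t (suc r) * t 1
    top-left = cong₂ (λ c e → sgn (suc r) * ι c * t (suc r) * t e) ([1+n]Cn≡1+n (suc r)) (ℕₚ.m+n∸n≡m 1 r)

    top-right : term (2 ℕ.+ r) (2 ℕ.+ r) ≡ (- sgn (suc r)) * 1ℚ * t (2 ℕ.+ r) * 1ℚ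
    top-right = cong₂ (λ c e → (- sgn (suc r)) * ι c * t (2 ℕ.+ r) * t e) (nCn≡1 (2 ℕ.+ r)) (ℕₚ.n∸n≡0 r)

    -- 0ℚ and 1ℚ stand for ι 0, ι 1 and t 0, which compute to them
    top : ∀ s R R₁ R₂ c w₁ w w′ q x → R₁ ≡ R + 1ℚ → R₂ ≡ R₁ + 1ℚ →
      x * (B + 0ℚ) ≡ s * R₁ * w * 1ℚ * (B + R) * q →
      w₁ * (B + 0ℚ) ≡ 1ℚ * (A + 0ℚ) → w′ * (B + R₁) ≡ w * (A + R₁) →
      (B + R) * (B + R + 1ℚ) * q ≡ - (c * (A * (B + R + ι 2) - B)) →
      (B + 0ℚ) * (B + R₁) ≢ 0ℚ →
      x ≡ - (c * (s * R₂ * w * w₁ + (- s) * 1ℚ * w′ * 1ℚ))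
    top s R _ _ c w₁ w w′ q x refl refl hx hw₁ hw′ hq nz = *-cancelʳ _ nz (begin
        x * ((B + 0ℚ) * (B + (R + 1ℚ)))
          ≡⟨ solve (x ∷ B ∷ R ∷ []) ℚ-ring ⟩
        x * (B + 0ℚ) * (B + (R + 1ℚ))
          ≡⟨ cong (_* (B + (R + 1ℚ))) hx ⟩
        s * (R + 1ℚ) * w * 1ℚ * (B + R) * q * (B + (R + 1ℚ))
          ≡⟨ solve (s ∷ R ∷ w ∷ B ∷ q ∷ []) ℚ-ring ⟩
        s * (R + 1ℚ) * w * ((B + R) * (B + R + 1ℚ) * q)
          ≡⟨ cong (s * (R + 1ℚ) * w *_) hq ⟩
        s * (R + 1ℚ) * w * (- (c * (A * (B + R + ι 2) - B)))
          ≡⟨ solve (s ∷ R ∷ w ∷ c ∷ A ∷ B ∷ []) ℚ-ring ⟩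
        - (c * s * ((R + 1ℚ + 1ℚ) * w * (B + (R + 1ℚ)) * (1ℚ * (A + 0ℚ)) - (B + 0ℚ) * (w * (A + (R + 1ℚ)))))
          ≡⟨ cong₂ (λ y z → - (c * s * ((R + 1ℚ + 1ℚ) * w * (B + (R + 1ℚ)) * y - (B + 0ℚ) * z))) hw₁ hw′ ⟨
        - (c * s * ((R + 1ℚ + 1ℚ) * w * (B + (R + 1ℚ)) * (w₁ * (B + 0ℚ)) - (B + 0ℚ) * (w′ * (B + (R + 1ℚ)))))
          ≡⟨ solve (c ∷ s ∷ R ∷ w ∷ B ∷ w₁ ∷ w′ ∷ []) ℚ-ring ⟩
        - (c * (s * (R + 1ℚ + 1ℚ) * w * w₁ + (- s) * 1ℚ * w′ * 1ℚ)) * ((B + 0ℚ) * (B + (R + 1ℚ))) ∎)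

  recurrence : ∀ r → rise B (2 ℕ.+ r) ≢ 0ℚ → c₂ (ι r) * S (2 ℕ.+ r) ≡ c₀ (ι r) * S r
  recurrence r B↑ = Σ≤-creative-telescoping r (c₂ (ι r)) (c₀ (ι r)) (term (2 ℕ.+ r)) (term r) (G r)
    refl (λ i≤r → telescopes i≤r B↑) (G-boundary r B↑)

  S-even-cleared : ∀ m {r} → r ≡ m ℕ.+ m → rise B r ≢ 0ℚ →
    S r * (fact m * (rise B r * rise B m)) ≡ fact r * (rise (B - A) m * rise A m)
  S-even-cleared zero    refl _ = refl
  S-even-cleared (suc m) {r} r≡ B↑ with trans r≡ (cong suc (ℕₚ.+-suc m m))
  ... | refl = step (S (2 ℕ.+ (m ℕ.+ m))) (S (m ℕ.+ m)) (fact m) (rise B (m ℕ.+ m)) (rise B m) (fact (m ℕ.+ m))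
                    (rise (B - A) m) (rise A m) (ι m) (ι (m ℕ.+ m)) (ι (suc (m ℕ.+ m))) (ι (2 ℕ.+ (m ℕ.+ m))) (ι (suc m))
                    (ι-+ m m) (ι-suc (m ℕ.+ m)) (ι-suc (suc (m ℕ.+ m))) (ι-suc m)
                    (recurrence (m ℕ.+ m) B↑)
                    (S-even-cleared m refl (rise≢0-mono (ℕₚ.m≤n+m (m ℕ.+ m) 2) B↑))
    where
    step : ∀ S₂ S₀ φ ρ β φ′ γ α M R R₁ R₂ M₁ → R ≡ M + M → R₁ ≡ R + 1ℚ → R₂ ≡ R₁ + 1ℚ → M₁ ≡ M + 1ℚ →
      (B + R) * (B + R + 1ℚ) * (ι 2 * B + R) * S₂ ≡ (R + 1ℚ) * (ι 2 * B - ι 2 * A + R) * (ι 2 * A + R) * S₀ →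
      S₀ * (φ * (ρ * β)) ≡ φ′ * (γ * α) →
      S₂ * ((φ * M₁) * (ρ * (B + R) * (B + R₁) * (β * (B + M)))) ≡ φ′ * R₁ * R₂ * (γ * (B - A + M) * (α * (A + M)))
    step S₂ S₀ φ ρ β φ′ γ α M _ _ _ _ refl refl refl refl hrec hS = *-cancelʳ (ι 2) (ι-suc≢0 1) (begin
        S₂ * ((φ * (M + 1ℚ)) * (ρ * (B + (M + M)) * (B + (M + M + 1ℚ)) * (β * (B + M)))) * ι 2
          ≡⟨ solve (S₂ ∷ φ ∷ M ∷ ρ ∷ B ∷ β ∷ []) ℚ-ring ⟩
        (B + (M + M)) * (B + (M + M) + 1ℚ) * (ι 2 * B + (M + M)) * S₂ * ((M + 1ℚ) * φ * ρ * β)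
          ≡⟨ cong (_* ((M + 1ℚ) * φ * ρ * β)) hrec ⟩
        (M + M + 1ℚ) * (ι 2 * B - ι 2 * A + (M + M)) * (ι 2 * A + (M + M)) * S₀ * ((M + 1ℚ) * φ * ρ * β)
          ≡⟨ solve (M ∷ B ∷ A ∷ S₀ ∷ φ ∷ ρ ∷ β ∷ []) ℚ-ring ⟩
        (M + M + 1ℚ) * (ι 2 * B - ι 2 * A + (M + M)) * (ι 2 * A + (M + M)) * (M + 1ℚ) * (S₀ * (φ * (ρ * β)))
          ≡⟨ cong ((M + M + 1ℚ) * (ι 2 * B - ι 2 * A + (M + M)) * (ι 2 * A + (M + M)) * (M + 1ℚ) *_) hS ⟩
        (M + M + 1ℚ) * (ι 2 * B - ι 2 * A + (M + M)) * (ι 2 * A + (M + M)) * (M + 1ℚ) * (φ′ * (γ * α))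
          ≡⟨ solve (M ∷ B ∷ A ∷ φ′ ∷ γ ∷ α ∷ []) ℚ-ring ⟩
        φ′ * (M + M + 1ℚ) * (M + M + 1ℚ + 1ℚ) * (γ * (B - A + M) * (α * (A + M))) * ι 2 ∎)

  dixon-value : ℕ → ℚ
  dixon-value m = (fact (m ℕ.+ m) ⊘ fact m) * ((rise (B - A) m * rise A m) ⊘ (rise B (m ℕ.+ m) * rise B m))

  S-even : ∀ m → rise B (m ℕ.+ m) ≢ 0ℚ → S (m ℕ.+ m) ≡ dixon-value m
  S-even m B↑ = begin
      S (m ℕ.+ m)
        ≡⟨ *≡⇒≡⊘ (*-≢0 (fact≢0 m) B↑↑) (S-even-cleared m refl B↑) ⟩
      (fact (m ℕ.+ m) * (rise (B - A) m * rise A m)) ⊘ (fact m * (rise B (m ℕ.+ m) * rise B m))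
        ≡⟨ ⊘-*-⊘ (fact (m ℕ.+ m)) (rise (B - A) m * rise A m) (fact≢0 m) B↑↑ ⟨
      (fact (m ℕ.+ m) ⊘ fact m) * ((rise (B - A) m * rise A m) ⊘ (rise B (m ℕ.+ m) * rise B m)) ∎
    where
    B↑↑ = *-≢0 B↑ (rise≢0-mono (ℕₚ.m≤m+n m m) B↑)

-- Reduction of Theorem 3.3 to Dixon's sum

module Reduction (s m : ℕ) (v k : ℚ) where

  r n : ℕ
  r = m ℕ.+ m
  n = s ℕ.∸ r

  a b A B H : ℚ
  a = k - ι s
  b = v - ι (s ℕ.+ s) + 1ℚ
  A = a + ι (suc n)
  B = b + ι n
  H = rise a (suc n) ⊘ rise b n

  open Dixon A B public

  module _ (r≤s : r ≤ s) (den≢0 : rise b s ≢ 0ℚ) where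

    s≡n+r : s ≡ n ℕ.+ r
    s≡n+r = sym (ℕₚ.m∸n+n≡m r≤s)

    b↑s≡b↑n*B↑r : rise b s ≡ rise b n * rise B r
    b↑s≡b↑n*B↑r = trans (cong (rise b) s≡n+r) (rise-+ b n r)

    b↑n≢0 : rise b n ≢ 0ℚ
    b↑n≢0 = *-≢0ˡ (rise B r) (subst (_≢ 0ℚ) b↑s≡b↑n*B↑r den≢0)

    B↑r≢0 : rise B r ≢ 0ℚ
    B↑r≢0 = *-≢0ʳ (rise b n) (subst (_≢ 0ℚ) b↑s≡b↑n*B↑r den≢0)

    h-split : ∀ {q} → q ≤ r → h s (n ℕ.+ q) v k ≡ H * t q
    h-split {q} q≤r = begin
        rise a (suc n ℕ.+ q) ⊘ rise b (n ℕ.+ q)             ≡⟨ cong₂ _⊘_ (rise-+ a (suc n) q) (rise-+ b n q) ⟩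
        (rise a (suc n) * rise A q) ⊘ (rise b n * rise B q) ≡⟨ ⊘-*-⊘ (rise a (suc n)) (rise A q) b↑n≢0 (rise≢0-mono q≤r B↑r≢0) ⟨
        H * t q                                              ∎

    LHS≡H²S : LHS s r v k ≡ H * H * S r
    LHS≡H²S = begin
        LHS s r v k                        ≡⟨ Σ≤-cong r summand ⟩
        Σ≤ r (λ i → H * H * term r i)      ≡⟨ *-distribˡ-Σ≤ r (H * H) (term r) ⟨
        H * H * S r                        ∎
      where
      pull : ∀ σ c H x y → σ * c * (H * x) * (H * y) ≡ H * H * (σ * c * x * y)
      pull = solve-∀ ℚ-ring

      summand : ∀ {i} → i ≤ r → sgn i * ι (r C i) * h s (n ℕ.+ i) v k * h s (s ℕ.∸ i) v k ≡ H * H * term r i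
      summand {i} i≤r = begin
          sgn i * ι (r C i) * h s (n ℕ.+ i) v k * h s (s ℕ.∸ i) v k
            ≡⟨ cong₂ (λ x y → sgn i * ι (r C i) * x * y) (h-split i≤r)
                     (trans (cong (λ e → h s e v k) s∸i≡n+[r∸i]) (h-split (ℕₚ.m∸n≤m r i))) ⟩
          sgn i * ι (r C i) * (H * t i) * (H * t (r ℕ.∸ i))
            ≡⟨ pull (sgn i) (ι (r C i)) H (t i) (t (r ℕ.∸ i)) ⟩
          H * H * term r i ∎
        where
        s∸i≡n+[r∸i] : s ℕ.∸ i ≡ n ℕ.+ (r ℕ.∸ i)
        s∸i≡n+[r∸i] = trans (cong (ℕ._∸ i) s≡n+r) (ℕₚ.+-∸-assoc n i≤r)

    RHS≡H²*dixon-value : RHS s r m v k ≡ H * H * dixon-value m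
    RHS≡H²*dixon-value = begin
        RHS s r m v k
          ≡⟨ cong₂ (λ x y → c * (x ⊘ y)) numerator denominator ⟩
        c * ((rise (B - A) m * (α₀ * rise A m) * α₀) ⊘ ((β₀ * rise B r) * (β₀ * rise B m)))
          ≡⟨ cong (c *_) (cong₂ _⊘_ (regroup α₀ α₀ (rise (B - A) m) (rise A m)) (interchange β₀ (rise B r) β₀ (rise B m))) ⟩
        c * (((α₀ * α₀) * γα) ⊘ ((β₀ * β₀) * ρβ))
          ≡⟨ cong (c *_) (⊘-*-⊘ (α₀ * α₀) γα (*-≢0 b↑n≢0 b↑n≢0) (*-≢0 B↑r≢0 B↑m≢0)) ⟨
        c * (((α₀ * α₀) ⊘ (β₀ * β₀)) * (γα ⊘ ρβ))
          ≡⟨ cong (λ x → c * (x * (γα ⊘ ρβ))) (⊘-*-⊘ α₀ α₀ b↑n≢0 b↑n≢0) ⟨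
        c * (H * H * (γα ⊘ ρβ))
          ≡⟨ x∙yz≈y∙xz c (H * H) (γα ⊘ ρβ) ⟩
        H * H * dixon-value m ∎
      where
      c = fact r ⊘ fact m
      γα = rise (B - A) m * rise A m
      ρβ = rise B r * rise B m
      α₀ = rise a (suc n)
      β₀ = rise b n

      B↑m≢0 : rise B m ≢ 0ℚ
      B↑m≢0 = rise≢0-mono (ℕₚ.m≤m+n m m) B↑r≢0

      s∸m≡n+m : s ℕ.∸ m ≡ n ℕ.+ m
      s∸m≡n+m = trans (cong (ℕ._∸ m) (trans s≡n+r (sym (ℕₚ.+-assoc n m m)))) (ℕₚ.m+n∸n≡m (n ℕ.+ m) m)

      v-k-s≡B-A : v - k - ι s ≡ B - A
      v-k-s≡B-A = sym (trans (cong₂ (λ x y → v - x + 1ℚ + ι n - (k - ι s + y)) (ι-+ s s) (ι-suc n))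
                             (simplify v k (ι s) (ι n)))
        where
        simplify : ∀ v k S N → v - (S + S) + 1ℚ + N - (k - S + (N + 1ℚ)) ≡ v - k - S
        simplify = solve-∀ ℚ-ring

      numerator : rise (v - k - ι s) m * rise a (s ℕ.∸ m ℕ.+ 1) * rise a (s ℕ.∸ r ℕ.+ 1)
                    ≡ rise (B - A) m * (α₀ * rise A m) * α₀
      numerator = cong₂ _*_
        (cong₂ _*_ (cong (λ x → rise x m) v-k-s≡B-A)
                   (trans (cong (rise a) (trans (cong (ℕ._+ 1) s∸m≡n+m) (ℕₚ.+-comm (n ℕ.+ m) 1))) (rise-+ a (suc n) m)))
        (cong (rise a) (ℕₚ.+-comm n 1))

      denominator : rise b s * rise b (s ℕ.∸ m) ≡ (β₀ * rise B r) * (β₀ * rise B m)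
      denominator = cong₂ _*_ b↑s≡b↑n*B↑r (trans (cong (rise b) s∸m≡n+m) (rise-+ b n m))

      regroup : ∀ x y z w → z * (x * w) * y ≡ (x * y) * (z * w)
      regroup = solve-∀ ℚ-ring

theorem3p3 : (s r m : ℕ) → r ≡ m ℕ.+ m → r ≤ s → (v k : ℚ) →
    den s v ≢ 0ℚ →
    LHS s r v k ≡ RHS s r m v k
theorem3p3 s _ m refl r≤s v k den≢0 = begin
    LHS s r v k                                   ≡⟨ LHS≡H²S r≤s den≢0 ⟩
    H * H * S r                                   ≡⟨ cong (H * H *_) (S-even m (B↑r≢0 r≤s den≢0)) ⟩
    H * H * dixon-value m                         ≡⟨ RHS≡H²*dixon-value r≤s den≢0 ⟨
    RHS s r m v k                                 ∎
  where open Reduction s m v k
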